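{- Let $\mathcal{H}$ be a hypergraph on vertex set $V=\{v_1,\dots,v_n\}$. For $i\le n$ let $V_i=\{v_1,\dots,v_i\}$ and $\mathcal{H}_i=(V_i,\{F\cap V_i\mid F\in\mathcal{H}\})$. Let $k<i\le n$ and $E\in\mathrm{ext}_k(\mathcal{H}_i)$. Then $E\setminus\{v_i\}\in\mathrm{ext}_k(\mathcal{H}_{i-1})$.
   Context: For a hypergraph $\mathcal{K}$ on a finite vertex set $W$: a $k$-trace on $W$ is a pair $(T,S)$ with $T\subseteq S\subseteq W$, $|S|=k$; a set $F\subseteq W$ realizes $(T,S)$ if $F\cap S=T$; $\mathrm{traces}_k(F,W)$ is the set of $k$-traces on $W$ realized by $F$ and $\mathrm{traces}_k(\mathcal{K})=\bigcup_{F\in\mathcal{K}}\mathrm{traces}_k(F,W)$. The $k$-extension $\mathrm{ext}_k(\mathcal{K})$ is the hypergraph on $W$ whose hyperedges are all $E\subseteq W$ with $\mathrm{traces}_k(E,W)\subseteq\mathrm{traces}_k(\mathcal{K})$. -}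

module Defs where

open import Data.Nat using (ℕ; _<ᵇ_; suc)
open import Data.Bool using (Bool; T)
open import Data.Fin using (Fin; toℕ)
open import Data.Fin.Subset using (Subset; _⊆_; _∩_; ∣_∣)
open import Data.Vec using (tabulate)
open import Data.Product using (Σ; _×_; ∃)
open import Relation.Binary.PropositionalEquality using (_≡_)

-- A hypergraph on a vertex set W ⊆ Fin n is given by its edge predicate
-- (which edges F ⊆ Fin n belong to it); edges are meant to be subsets of W.
Hypergraph : ℕ → Set₁
Hypergraph n = Subset n → Set

IsTrace : ∀ {n} → ℕ → Subset n → Subset n → Subset n → Set
IsTrace k W T S = T ⊆ S × S ⊆ W × ∣ S ∣ ≡ k

Realizes : ∀ {n} → Subset n → Subset n → Subset n → Set
Realizes F T S = F ∩ S ≡ T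

InTraces : ∀ {n} → ℕ → Subset n → Hypergraph n → Subset n → Subset n → Set
InTraces k W K T S = IsTrace k W T S × Σ (Subset _) (λ F → K F × Realizes F T S)

InExt : ∀ {n} → ℕ → Subset n → Hypergraph n → Subset n → Set
InExt k W K E = E ⊆ W × (∀ T S → IsTrace k W T S → Realizes E T S → InTraces k W K T S)

-- V_i = {v_1,…,v_i}; vertex v_j is represented by the element j-1 of Fin n.
Prefix : (n i : ℕ) → Subset n
Prefix n i = tabulate (λ (j : Fin n) → toℕ j <ᵇ i)

Restrict : ∀ {n} → Hypergraph n → ℕ → Hypergraph n
Restrict {n} H i G = ∃ (λ F → H F × G ≡ F ∩ Prefix n i)

{-# OPTIONS --safe #-}
module Submission where

-- Traces of size k on V_{i-1} only see E ∩ V_{i-1}, and since every such trace is also a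
-- trace on V_i, the extension property of E on V_i passes to E ∩ V_{i-1}; a member F ∩ V_i
-- of H_i realizing the trace yields the member F ∩ V_{i-1} of H_{i-1} realizing it. Because
-- E ⊆ V_i, the set E ∩ V_{i-1} is exactly E ∖ {v_i}.

open import Defs
open import Data.Nat using (ℕ; _<_; _≤_; suc)
open import Data.Nat.Properties using (<ᵇ⇒<; <⇒<ᵇ; ≤∧≢⇒<; <-≤-trans; <-irrefl; n≤1+n; ≤-pred)
open import Data.Bool using (true; false)
open import Data.Bool.Properties using (T-≡)
open import Data.Fin using (Fin; toℕ; _≟_)
open import Data.Fin.Properties using (toℕ-injective)
open import Data.Fin.Subset using (Subset; _-_; _─_; _∩_; _∪_; _⊆_; _∈_; _∉_; ⁅_⁆)
open import Data.Fin.Subset.Properties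
  using (⊆-antisym; ⊆-trans; ∩-assoc; p∩q⊆q; x∈p∩q⁺; x∈p∩q⁻; x∈p∪q⁻; x∈p∪q⁺; p─q⊆p;
         x∈p∧x≢y⇒x∈p-y; x∈⁅y⁆⇒x≡y; x∉⁅y⁆⇒x≢y; x∈⁅x⁆)
open import Data.Vec.Properties using (lookup∘tabulate; []=⇒lookup; lookup⇒[]=)
open import Data.Vec using (_∷_; here; there)
open import Data.Product using (_,_)
open import Data.Sum using (inj₁; inj₂)
open import Function.Bundles using (Equivalence)
open import Relation.Binary.PropositionalEquality
  using (_≡_; _≢_; refl; sym; trans; cong; subst; module ≡-Reasoning)
open import Relation.Nullary using (yes; no; contradiction)
open import Function using (_∘_)

private
  variable
    n m m′ k : ℕ
    x y : Fin n
    p q E F T S W W′ : Subset n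

p⊆q⇒q∩p≡p : p ⊆ q → q ∩ p ≡ p
p⊆q⇒q∩p≡p {q = q} p⊆q = ⊆-antisym (p∩q⊆q q _) (λ y∈p → x∈p∩q⁺ (p⊆q y∈p , y∈p))

r⊆q⇒p∩q∩r≡p∩r : ∀ {p q r : Subset n} → r ⊆ q → (p ∩ q) ∩ r ≡ p ∩ r
r⊆q⇒p∩q∩r≡p∩r {p = p} {q} {r} r⊆q = begin
  (p ∩ q) ∩ r  ≡⟨ ∩-assoc p q r ⟩
  p ∩ (q ∩ r)  ≡⟨ cong (p ∩_) (p⊆q⇒q∩p≡p r⊆q) ⟩
  p ∩ r        ∎
  where open ≡-Reasoning

x∈p─q⇒x∉q : x ∈ p ─ q → x ∉ q
x∈p─q⇒x∉q {p = true ∷ _} {q = false ∷ _} here       ()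
x∈p─q⇒x∉q {p = _ ∷ _}    {q = _ ∷ _}     (there x∈) (there x∈q) = x∈p─q⇒x∉q x∈ x∈q

x∈p-y⇒x≢y : x ∈ p - y → x ≢ y
x∈p-y⇒x≢y x∈ = x∉⁅y⁆⇒x≢y (x∈p─q⇒x∉q x∈)

p⊆q∪⁅x⁆∧x∉q⇒p-x≡p∩q : p ⊆ q ∪ ⁅ x ⁆ → x ∉ q → p - x ≡ p ∩ q
p⊆q∪⁅x⁆∧x∉q⇒p-x≡p∩q {p = p} {q = q} {x = x} p⊆q∪x x∉q = ⊆-antisym ⊆∩ ∩⊆
  where
  ⊆∩ : p - x ⊆ p ∩ q
  ⊆∩ y∈p-x with y∈p ← p─q⊆p p ⁅ x ⁆ y∈p-x | x∈p∪q⁻ q ⁅ x ⁆ (p⊆q∪x y∈p)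
  ... | inj₁ y∈q  = x∈p∩q⁺ (y∈p , y∈q)
  ... | inj₂ y∈⁅x⁆ = contradiction (x∈⁅y⁆⇒x≡y x y∈⁅x⁆) (x∈p-y⇒x≢y y∈p-x)
  ∩⊆ : p ∩ q ⊆ p - x
  ∩⊆ y∈p∩q with y∈p , y∈q ← x∈p∩q⁻ p q y∈p∩q =
    x∈p∧x≢y⇒x∈p-y y∈p (λ { refl → x∉q y∈q })

∈-Prefix⁺ : ∀ {n m} {j : Fin n} → toℕ j < m → j ∈ Prefix n m
∈-Prefix⁺ {n} {m} {j} j<m =
  lookup⇒[]= j (Prefix n m)
    (trans (lookup∘tabulate _ j) (Equivalence.to T-≡ (<⇒<ᵇ j<m)))

∈-Prefix⁻ : ∀ {n m} {j : Fin n} → j ∈ Prefix n m → toℕ j < m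
∈-Prefix⁻ {n} {m} {j} j∈ =
  <ᵇ⇒< (toℕ j) m
    (Equivalence.from T-≡ (trans (sym (lookup∘tabulate _ j)) ([]=⇒lookup j∈)))

Prefix-mono : m ≤ m′ → Prefix n m ⊆ Prefix n m′
Prefix-mono m≤m′ j∈ = ∈-Prefix⁺ (<-≤-trans (∈-Prefix⁻ j∈) m≤m′)

x∉Prefix[toℕx] : x ∉ Prefix n (toℕ x)
x∉Prefix[toℕx] x∈ = <-irrefl refl (∈-Prefix⁻ x∈)

Prefix[1+toℕx]⊆Prefix[toℕx]∪⁅x⁆ : Prefix n (suc (toℕ x)) ⊆ Prefix n (toℕ x) ∪ ⁅ x ⁆
Prefix[1+toℕx]⊆Prefix[toℕx]∪⁅x⁆ {x = x} {j} j∈ with j ≟ x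
... | yes refl = x∈p∪q⁺ (inj₂ (x∈⁅x⁆ x))
... | no j≢x  = x∈p∪q⁺ (inj₁ (∈-Prefix⁺ (≤∧≢⇒< (≤-pred (∈-Prefix⁻ j∈)) (j≢x ∘ toℕ-injective))))

IsTrace-mono : W ⊆ W′ → IsTrace k W T S → IsTrace k W′ T S
IsTrace-mono W⊆W′ (T⊆S , S⊆W , ∣S∣≡k) = T⊆S , ⊆-trans S⊆W W⊆W′ , ∣S∣≡k

Realizes-∩⁺ : S ⊆ W → Realizes F T S → Realizes (F ∩ W) T S
Realizes-∩⁺ S⊆W F∩S≡T = trans (r⊆q⇒p∩q∩r≡p∩r S⊆W) F∩S≡T

Realizes-∩⁻ : S ⊆ W → Realizes (F ∩ W) T S → Realizes F T S
Realizes-∩⁻ S⊆W F∩W∩S≡T = trans (sym (r⊆q⇒p∩q∩r≡p∩r S⊆W)) F∩W∩S≡T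

InTraces-Restrict-mono : ∀ {H : Hypergraph n} → m ≤ m′ → IsTrace k (Prefix n m) T S →
  InTraces k (Prefix n m′) (Restrict H m′) T S → InTraces k (Prefix n m) (Restrict H m) T S
InTraces-Restrict-mono {n = n} {m = m} m≤m′ tr@(_ , S⊆V , _) (_ , _ , (F , F∈H , refl) , G∩S≡T) =
  tr , F ∩ Prefix n m , (F , F∈H , refl) ,
  Realizes-∩⁺ S⊆V (Realizes-∩⁻ (⊆-trans S⊆V (Prefix-mono m≤m′)) G∩S≡T)

InExt-Restrict-∩Prefix : ∀ {H : Hypergraph n} → m ≤ m′ →
  InExt k (Prefix n m′) (Restrict H m′) E →
  InExt k (Prefix n m) (Restrict H m) (E ∩ Prefix n m)
InExt-Restrict-∩Prefix {E = E} m≤m′ (_ , ext) =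
  p∩q⊆q E _ , λ T S tr@(_ , S⊆V , _) E∩V∩S≡T →
    InTraces-Restrict-mono m≤m′ tr
      (ext T S (IsTrace-mono (Prefix-mono m≤m′) tr) (Realizes-∩⁻ S⊆V E∩V∩S≡T))

lemma5 : ∀ {n} (H : Hypergraph n) (k : ℕ) (x : Fin n) (E : Subset n) →
    k < suc (toℕ x) →
    InExt k (Prefix n (suc (toℕ x))) (Restrict H (suc (toℕ x))) E →
    InExt k (Prefix n (toℕ x)) (Restrict H (toℕ x)) (E - x)
lemma5 {n} H k x E _ E∈ext@(E⊆V , _) =
  subst (InExt k (Prefix n (toℕ x)) (Restrict H (toℕ x))) (sym E-x≡E∩V)
    (InExt-Restrict-∩Prefix (n≤1+n (toℕ x)) E∈ext)
  where
  E-x≡E∩V : E - x ≡ E ∩ Prefix n (toℕ x)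
  E-x≡E∩V = p⊆q∪⁅x⁆∧x∉q⇒p-x≡p∩q
    (⊆-trans E⊆V Prefix[1+toℕx]⊆Prefix[toℕx]∪⁅x⁆) x∉Prefix[toℕx]
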